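{- Let $n\ge1$ and $g:\mathbb{Z}_n\to\mathbb{Z}_n$ with $|g^{(n-1)}(\mathbb{Z}_n)|=1$. Then $\Phi(g)\neq\varnothing$ (i.e. $G_g$ admits a $\vec{\beta}$-labeling) if and only if the canonical representative $\overline{\mathcal{P}}_g(\mathbf{x})$ of $\mathcal{P}_g(\mathbf{x})$ modulo $\{(x_k)^{\underline{n}}:k\in\mathbb{Z}_n\}$ is not identically zero.
   Context: $\mathbb{Z}_n=\{0,\ldots,n-1\}$ as integers. For $g:\mathbb{Z}_n\to\mathbb{Z}_n$, $g^{(0)}=\mathrm{id}$, $g^{(j+1)}=g\circ g^{(j)}$. If $|g^{(n-1)}(\mathbb{Z}_n)|=1$, $g$ has a unique root $r$ with $g(r)=r$, $G_g$ is the directed graph on $\mathbb{Z}_n$ with edges $(v,g(v))$, and $d_g(v)$ is the least $j\ge0$ with $g^{(j)}(v)=r$. $\mathrm{S}_n$ is the set of bijections of $\mathbb{Z}_n$, and $\Phi(g)=\{\varphi\in\mathrm{S}_n:\{(-1)^{d_{\varphi g\varphi^{ -1}}(v)}(\varphi g\varphi^{ -1}(v)-v):v\in\mathbb{Z}_n\}=\mathbb{Z}_n\}$ (integer arithmetic); $G_g$ admits a $\vec{\beta}$-labeling iff $\Phi(g)\ne\varnothing$. With $\mathbf{x}=(x_0,\ldots,x_{n-1})$ and $\mathfrak{e}_v=(-1)^{d_g(v)}(x_{g(v)}-x_v)$, $$\mathcal{P}_g(\mathbf{x})=\prod_{0\le u<v<n}(x_v-x_u)\cdot\prod_{0\le u<v<n}(\mathfrak{e}_v-\mathfrak{e}_u)\cdot\prod_{0\le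 v<n}\prod_{0<i<n}(\mathfrak{e}_v+i).$$ Here $x^{\underline{n}}=x(x-1)\cdots(x-n+1)$, and the canonical representative $\overline{H}$ of $H\in\mathbb{Q}[\mathbf{x}]$ is the unique polynomial of degree at most $n-1$ in each variable congruent to $H$ modulo the ideal generated by $\{(x_k)^{\underline{n}}\}$; explicitly $\overline{H}=\sum_{f\in\mathbb{Z}_n^{\mathbb{Z}_n}}H(f(0),\ldots,f(n-1))L_f(\mathbf{x})$ with $L_f(\mathbf{x})=\prod_{i\in\mathbb{Z}_n}\prod_{j\in\mathbb{Z}_n\setminus\{f(i)\}}\frac{x_i-j}{f(i)-j}$. -}

module Defs where

open import Data.Nat as ℕ using (ℕ; zero; suc; _∸_; _<ᵇ_)
open import Data.Bool using (Bool; true; false; if_then_else_)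
open import Data.Fin as Fin using (Fin; toℕ)
open import Data.List using (List; []; _∷_; map)
open import Data.Integer as ℤ using (ℤ; +_)
open import Data.Rational as ℚ using (ℚ; 0ℚ; 1ℚ)
open import Data.Rational.Properties using () renaming (_≟_ to _≟ℚ_)
open import Data.Vec.Functional using () renaming (_∷_ to _∷ᶠ_)
open import Data.Product using (Σ; ∃; _×_)
open import Function.Bundles using (_↔_; Inverse)
open import Relation.Nullary using (does; yes; no)
open import Relation.Binary.PropositionalEquality using (_≡_; _≢_)

iter : ∀ {n} → (Fin n → Fin n) → ℕ → Fin n → Fin n
iter g zero    v = v
iter g (suc j) v = g (iter g j v)

-- Hypothesis |g^(n-1)(Z_n)| = 1 (for n ≥ 1 the image is nonempty,
-- so this says g^(n-1) is constant).
RootedFun : ∀ n → (Fin n → Fin n) → Set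
RootedFun n g = ∀ u v → iter g (n ∸ 1) u ≡ iter g (n ∸ 1) v

-- d_g(v): least j ≥ 0 with g^(j)(v) = r.  Under RootedFun the root r
-- equals g^(n-1)(v) for every v, and d_g(v) ≤ n-1, so a bounded
-- search over j < n finds it (the fallback value n is never reached).

firstFrom : ℕ → ℕ → (ℕ → Bool) → ℕ
firstFrom j zero       p = j
firstFrom j (suc fuel) p = if p j then j else firstFrom (suc j) fuel p

root : ∀ {n} → (Fin n → Fin n) → Fin n → Fin n
root {n} g v = iter g (n ∸ 1) v

depth : ∀ {n} → (Fin n → Fin n) → Fin n → ℕ
depth {n} g v = firstFrom 0 n (λ j → does (iter g j v Fin.≟ root g v))

negPowℤ : ℕ → ℤ
negPowℤ zero    = + 1
negPowℤ (suc k) = ℤ.- negPowℤ k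

labelℤ : ∀ {n} → (Fin n → Fin n) → Fin n → ℤ
labelℤ h v = negPowℤ (depth h v) ℤ.* ((+ toℕ (h v)) ℤ.- (+ toℕ v))

conj : ∀ {n} → (Fin n ↔ Fin n) → (Fin n → Fin n) → (Fin n → Fin n)
conj φ g v = Inverse.to φ (g (Inverse.from φ v))

LabelsAreZn : ∀ {n} → (Fin n → Fin n) → Set
LabelsAreZn {n} h =
  (∀ (v : Fin n) → ∃ λ (k : Fin n) → labelℤ h v ≡ + toℕ k)
  × (∀ (k : Fin n) → ∃ λ (v : Fin n) → labelℤ h v ≡ + toℕ k)

InPhi : ∀ {n} → (Fin n → Fin n) → (Fin n ↔ Fin n) → Set
InPhi g φ = LabelsAreZn (conj φ g)

PhiNonempty : ∀ {n} → (Fin n → Fin n) → Set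
PhiNonempty {n} g = Σ (Fin n ↔ Fin n) (InPhi g)

sumFin : ∀ {k} → (Fin k → ℚ) → ℚ
sumFin {zero}  F = 0ℚ
sumFin {suc k} F = F Fin.zero ℚ.+ sumFin (λ i → F (Fin.suc i))

prodFin : ∀ {k} → (Fin k → ℚ) → ℚ
prodFin {zero}  F = 1ℚ
prodFin {suc k} F = F Fin.zero ℚ.* prodFin (λ i → F (Fin.suc i))

sumFuns : ∀ {n} m → ((Fin m → Fin n) → ℚ) → ℚ
sumFuns zero    F = F (λ ())
sumFuns (suc m) F = sumFin (λ c → sumFuns m (λ h → F (c ∷ᶠ h)))

prodPairs : ∀ {n} → (Fin n → Fin n → ℚ) → ℚ
prodPairs F = prodFin (λ v → prodFin (λ u → if toℕ u <ᵇ toℕ v then F u v else 1ℚ))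

ℕtoℚ : ℕ → ℚ
ℕtoℚ k = (+ k) ℚ./ 1

negPowℚ : ℕ → ℚ
negPowℚ zero    = 1ℚ
negPowℚ (suc k) = ℚ.- negPowℚ k

edgeVal : ∀ {n} → (Fin n → Fin n) → (Fin n → ℚ) → Fin n → ℚ
edgeVal g x v = negPowℚ (depth g v) ℚ.* (x (g v) ℚ.- x v)

evalP : ∀ {n} → (Fin n → Fin n) → (Fin n → ℚ) → ℚ
evalP {n} g x =
  prodPairs (λ u v → x v ℚ.- x u)
  ℚ.* prodPairs (λ u v → edgeVal g x v ℚ.- edgeVal g x u)
  ℚ.* prodFin (λ v → prodFin (λ (i : Fin n) →
        if toℕ i ℕ.≡ᵇ 0 then 1ℚ else edgeVal g x v ℚ.+ ℕtoℚ (toℕ i)))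

-- Univariate polynomials over ℚ as coefficient lists (constant term first)

polyAdd : List ℚ → List ℚ → List ℚ
polyAdd []      q       = q
polyAdd (a ∷ p) []      = a ∷ p
polyAdd (a ∷ p) (b ∷ q) = (a ℚ.+ b) ∷ polyAdd p q

polyScale : ℚ → List ℚ → List ℚ
polyScale c p = map (c ℚ.*_) p

polyMul : List ℚ → List ℚ → List ℚ
polyMul []      q = []
polyMul (a ∷ p) q = polyAdd (polyScale a q) (0ℚ ∷ polyMul p q)

coeffAt : List ℚ → ℕ → ℚ
coeffAt []      k       = 0ℚ
coeffAt (a ∷ p) zero    = a
coeffAt (a ∷ p) (suc k) = coeffAt p k

polyProdFin : ∀ {k} → (Fin k → List ℚ) → List ℚ
polyProdFin {zero}  F = 1ℚ ∷ []
polyProdFin {suc k} F = polyMul (F Fin.zero) (polyProdFin (λ i → F (Fin.suc i)))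

-- reciprocal (only ever applied to nonzero arguments below)
recip : ℚ → ℚ
recip q with q ≟ℚ 0ℚ
... | yes _  = 0ℚ
... | no q≢0 = ℚ.1/_ q {{ℚ.≢-nonZero q≢0}}

-- univariate Lagrange factor  ∏_{j ∈ Z_n \ {c}} (t - j)/(c - j)
lagrange : ∀ n → Fin n → List ℚ
lagrange n c =
  polyScale (recip (prodFin (λ (j : Fin n) →
                 if does (j Fin.≟ c) then 1ℚ else ℕtoℚ (toℕ c) ℚ.- ℕtoℚ (toℕ j))))
            (polyProdFin (λ (j : Fin n) →
                 if does (j Fin.≟ c) then 1ℚ ∷ [] else (ℚ.- ℕtoℚ (toℕ j)) ∷ 1ℚ ∷ []))

-- coefficient of the monomial ∏_i x_i^{a(i)} in L_f(x) = ∏_i lagrange n (f i) (x_i)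
coeffL : ∀ {n} → (Fin n → Fin n) → (Fin n → Fin n) → ℚ
coeffL {n} f a = prodFin (λ i → coeffAt (lagrange n (f i)) (toℕ (a i)))

-- coefficient of ∏_i x_i^{a(i)} (0 ≤ a(i) ≤ n-1) in the canonical representative
--   \overline{P_g} = Σ_f P_g(f(0),…,f(n-1)) L_f(x)
canonCoeff : ∀ {n} → (Fin n → Fin n) → (Fin n → Fin n) → ℚ
canonCoeff {n} g a =
  sumFuns n (λ f → evalP g (λ i → ℕtoℚ (toℕ (f i))) ℚ.* coeffL f a)

CanonNonzero : ∀ {n} → (Fin n → Fin n) → Set
CanonNonzero {n} g = ∃ λ (a : Fin n → Fin n) → canonCoeff g a ≢ 0ℚ

{-# OPTIONS --safe #-}
-- Both conditions are equivalent to P_g(t) ≠ 0 at some grid point t ∈ ℤ_n^n.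
--
-- The canonical representative interpolates P_g on the grid, since L_f(t) = [f = t] there.
-- Its coefficients are linear in the grid values of P_g, and the grid values are recovered
-- from the coefficients by evaluation, so the coefficients all vanish iff P_g vanishes on
-- the grid.
--
-- At a grid point the three factors of P_g(t) are nonzero iff t is injective, the edge labels
-- ℓ(v) = (-1)^{d(v)} (t(g v) - t(v)) are pairwise distinct, and no ℓ(v) lies in
-- {-1, …, -(n-1)}. As |ℓ(v)| < n, the last two conditions say that the labels are exactly ℤ_n.
-- Conjugating g by the bijection t turns ℓ into the labels of t g t⁻¹, so this is t ∈ Φ(g).
module Submission where

open import Defs
open import Algebra.Bundles using (CommutativeMonoid)
import Algebra.Properties.CommutativeSemigroup as CommSemigroupProps
import Algebra.Properties.Group as GroupProps
open import Data.Bool using (Bool; true; false; if_then_else_)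
import Data.Bool.Properties as BoolP
open import Data.Fin as Fin using (Fin; zero; suc; toℕ)
import Data.Fin.Properties as FinP
open import Data.Integer as ℤ using (ℤ; -[1+_]; 0ℤ; ∣_∣)
import Data.Integer.Properties as ℤP
open import Data.List using (List; []; _∷_; length)
import Data.List.Properties as ListP
open import Data.Nat as ℕ using (ℕ; zero; suc; _≤_; _<_; _⊔_; _∸_; z≤n; s≤s)
import Data.Nat.Properties as ℕP
open import Data.Product using (∃; _×_; _,_; proj₁; proj₂)
open import Data.Product.Function.NonDependent.Propositional using (_×-⇔_)
open import Data.Sum using (_⊎_; inj₁; inj₂)
open import Data.Rational as ℚ using (ℚ; 0ℚ; 1ℚ; _+_; _*_; -_; _-_; 1/_)
import Data.Rational.Properties as ℚP
open import Data.Rational.Solver using (module +-*-Solver)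
open import Algebra.Definitions.RawSemiring ℚ.+-*-rawSemiring using (_^_)
open import Data.Rational.Unnormalised as ℚᵘ using (mkℚᵘ; *≡*) renaming (_≃_ to _≃ᵘ_)
import Data.Rational.Unnormalised.Properties as ℚᵘP
open import Data.Vec.Functional using (head; tail) renaming (_∷_ to _∷ᶠ_)
open import Data.Vec.Functional.Properties using (∷-cong)
open import Function using (_∘_; _↔_; _⇔_; Inverse; Injection; Equivalence; mk⇔; mk↔ₛ′)
open import Function.Definitions using (Injective; StrictlySurjective)
open import Function.Properties.Equivalence using () renaming (trans to ⇔-trans; sym to ⇔-sym)
open import Function.Properties.Inverse using (↔⇒↣)
open import Relation.Binary.Core using (_Preserves_⟶_)
open import Relation.Binary.Definitions using (tri<; tri≈; tri>)
open import Relation.Binary.PropositionalEquality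
open import Relation.Nullary using (Dec; yes; no; does; contradiction)
import Relation.Nullary.Decidable as Dec
open import Relation.Unary using (Decidable)

open +-*-Solver using (solve; _:+_; _:*_; _:-_; :-_; _:=_; con)

private
  module +-Props = CommSemigroupProps (CommutativeMonoid.commutativeSemigroup ℚP.+-0-commutativeMonoid)
  module *-Props = CommSemigroupProps (CommutativeMonoid.commutativeSemigroup ℚP.*-1-commutativeMonoid)
  module +-GroupProps = GroupProps ℚP.+-0-group

*-≢0 : ∀ {p q} → p ≢ 0ℚ → q ≢ 0ℚ → p * q ≢ 0ℚ
*-≢0 {p} {q} p≢0 q≢0 pq≡0 = q≢0 (begin
  q                ≡⟨ ℚP.*-identityˡ q ⟨
  1ℚ * q           ≡⟨ cong (_* q) (ℚP.*-inverseˡ p) ⟨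
  1/ p * p * q     ≡⟨ ℚP.*-assoc (1/ p) p q ⟩
  1/ p * (p * q)   ≡⟨ cong (1/ p *_) pq≡0 ⟩
  1/ p * 0ℚ        ≡⟨ ℚP.*-zeroʳ (1/ p) ⟩
  0ℚ               ∎)
  where
  instance
    p-nonZero : ℚ.NonZero p
    p-nonZero = ℚ.≢-nonZero p≢0
  open ≡-Reasoning

*-≢0⇔ : ∀ {p q} → p * q ≢ 0ℚ ⇔ (p ≢ 0ℚ × q ≢ 0ℚ)
*-≢0⇔ {p} {q} = mk⇔
  (λ pq≢0 → (λ p≡0 → pq≢0 (trans (cong (_* q) p≡0) (ℚP.*-zeroˡ q)))
          , (λ q≡0 → pq≢0 (trans (cong (p *_) q≡0) (ℚP.*-zeroʳ p))))
  (λ (p≢0 , q≢0) → *-≢0 p≢0 q≢0)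

recip-inverseˡ : ∀ {q} → q ≢ 0ℚ → recip q * q ≡ 1ℚ
recip-inverseˡ {q} q≢0 with q ℚP.≟ 0ℚ
... | yes q≡0 = contradiction q≡0 q≢0
... | no  q≢0 = ℚP.*-inverseˡ q {{ℚ.≢-nonZero q≢0}}

ℤtoℚ : ℤ → ℚ
ℤtoℚ i = i ℚ./ 1

private
  toℚᵘ-ℤtoℚ : ∀ i → ℚ.toℚᵘ (ℤtoℚ i) ≃ᵘ mkℚᵘ i 0
  toℚᵘ-ℤtoℚ i = ℚP.toℚᵘ-fromℚᵘ (mkℚᵘ i 0)

ℤtoℚ-injective : Injective _≡_ _≡_ ℤtoℚ
ℤtoℚ-injective {i} {j} eq with ℚP.fromℚᵘ-injective {mkℚᵘ i 0} {mkℚᵘ j 0} eq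
... | *≡* i*1≡j*1 = trans (sym (ℤP.*-identityʳ i)) (trans i*1≡j*1 (ℤP.*-identityʳ j))

ℕtoℚ-injective : Injective _≡_ _≡_ ℕtoℚ
ℕtoℚ-injective eq = ℤP.+-injective (ℤtoℚ-injective eq)

ℤtoℚ-homo-+ : ∀ i j → ℤtoℚ (i ℤ.+ j) ≡ ℤtoℚ i + ℤtoℚ j
ℤtoℚ-homo-+ i j = ℚP.toℚᵘ-injective (begin
  ℚ.toℚᵘ (ℤtoℚ (i ℤ.+ j))               ≈⟨ toℚᵘ-ℤtoℚ (i ℤ.+ j) ⟩
  mkℚᵘ (i ℤ.+ j) 0                       ≈⟨ *≡* (cong (ℤ._* ℤ.1ℤ) (sym i*1+j*1≡i+j)) ⟩
  mkℚᵘ i 0 ℚᵘ.+ mkℚᵘ j 0                 ≈⟨ ℚᵘP.+-cong (toℚᵘ-ℤtoℚ i) (toℚᵘ-ℤtoℚ j) ⟨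
  ℚ.toℚᵘ (ℤtoℚ i) ℚᵘ.+ ℚ.toℚᵘ (ℤtoℚ j)   ≈⟨ ℚP.toℚᵘ-homo-+ (ℤtoℚ i) (ℤtoℚ j) ⟨
  ℚ.toℚᵘ (ℤtoℚ i + ℤtoℚ j)               ∎)
  where
  open ℚᵘP.≃-Reasoning
  i*1+j*1≡i+j : i ℤ.* ℤ.1ℤ ℤ.+ j ℤ.* ℤ.1ℤ ≡ i ℤ.+ j
  i*1+j*1≡i+j = cong₂ ℤ._+_ (ℤP.*-identityʳ i) (ℤP.*-identityʳ j)

ℤtoℚ-homo-* : ∀ i j → ℤtoℚ (i ℤ.* j) ≡ ℤtoℚ i * ℤtoℚ j
ℤtoℚ-homo-* i j = ℚP.toℚᵘ-injective (begin
  ℚ.toℚᵘ (ℤtoℚ (i ℤ.* j))               ≈⟨ toℚᵘ-ℤtoℚ (i ℤ.* j) ⟩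
  mkℚᵘ i 0 ℚᵘ.* mkℚᵘ j 0                 ≈⟨ ℚᵘP.*-cong (toℚᵘ-ℤtoℚ i) (toℚᵘ-ℤtoℚ j) ⟨
  ℚ.toℚᵘ (ℤtoℚ i) ℚᵘ.* ℚ.toℚᵘ (ℤtoℚ j)   ≈⟨ ℚP.toℚᵘ-homo-* (ℤtoℚ i) (ℤtoℚ j) ⟨
  ℚ.toℚᵘ (ℤtoℚ i * ℤtoℚ j)               ∎)
  where open ℚᵘP.≃-Reasoning

ℤtoℚ-homo‿- : ∀ i → ℤtoℚ (ℤ.- i) ≡ - ℤtoℚ i
ℤtoℚ-homo‿- (ℤ.+ zero)  = refl
ℤtoℚ-homo‿- (ℤ.+ suc n) = refl
ℤtoℚ-homo‿- -[1+ n ]    = sym (+-GroupProps.⁻¹-involutive _)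

ℤtoℚ-homo-- : ∀ i j → ℤtoℚ (i ℤ.- j) ≡ ℤtoℚ i - ℤtoℚ j
ℤtoℚ-homo-- i j = trans (ℤtoℚ-homo-+ i (ℤ.- j)) (cong (ℤtoℚ i +_) (ℤtoℚ-homo‿- j))

injective⇒strictlySurjective : ∀ {n} {f : Fin n → Fin n} →
                               Injective _≡_ _≡_ f → StrictlySurjective _≡_ f
injective⇒strictlySurjective {suc m} {f} f-inj y with FinP.any? (λ x → f x Fin.≟ y)
... | yes hit = hit
... | no miss = contradiction (FinP.injective⇒≤ {f = skip-y} skip-y-injective) ℕP.1+n≰n
  where
  y≢f : ∀ x → y ≢ f x
  y≢f x y≡fx = miss (x , sym y≡fx)
  skip-y : Fin (suc m) → Fin m
  skip-y x = Fin.punchOut (y≢f x)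
  skip-y-injective : Injective _≡_ _≡_ skip-y
  skip-y-injective eq = f-inj (FinP.punchOut-injective (y≢f _) (y≢f _) eq)

strictlySurjective⇒injective : ∀ {n} {f : Fin n → Fin n} →
                               StrictlySurjective _≡_ f → Injective _≡_ _≡_ f
strictlySurjective⇒injective {n} {f} f-surj {a} {b} fa≡fb =
  trans (sym (s∘f a)) (trans (cong s fa≡fb) (s∘f b))
  where
  s : Fin n → Fin n
  s = proj₁ ∘ f-surj
  f∘s : ∀ y → f (s y) ≡ y
  f∘s = proj₂ ∘ f-surj
  s-injective : Injective _≡_ _≡_ s
  s-injective {y} {y′} eq = trans (sym (f∘s y)) (trans (cong f eq) (f∘s y′))
  s∘f : ∀ x → s (f x) ≡ x
  s∘f x with y , refl ← injective⇒strictlySurjective s-injective x = cong s (f∘s y)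

injective⇒↔ : ∀ {n} {f : Fin n → Fin n} → Injective _≡_ _≡_ f → Fin n ↔ Fin n
injective⇒↔ {f = f} f-inj =
  mk↔ₛ′ f (proj₁ ∘ f-surj) (proj₂ ∘ f-surj) (λ x → f-inj (proj₂ (f-surj (f x))))
  where
  f-surj : StrictlySurjective _≡_ f
  f-surj = injective⇒strictlySurjective f-inj

-- P must respect _≗_ since f and head f ∷ tail f are only pointwise equal.
anyFun? : ∀ m {n} {P : (Fin m → Fin n) → Set} →
          (∀ {f f′} → f ≗ f′ → P f → P f′) → Decidable P → Dec (∃ P)
anyFun? zero {n} resp P? = Dec.map′ (empty ,_) (λ (f , p) → resp (λ ()) p) (P? empty)
  where
  empty : Fin zero → Fin n
  empty ()
anyFun? (suc m) resp P? =
  Dec.map′ (λ (c , h , p) → c ∷ᶠ h , p)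
           (λ (f , p) → head f , tail f , resp (∷-cong refl λ _ → refl) p)
           (FinP.any? λ c → anyFun? m (resp ∘ ∷-cong refl) (λ h → P? (c ∷ᶠ h)))

nonzero⊎zero : ∀ m {n} {F : (Fin m → Fin n) → ℚ} → F Preserves _≗_ ⟶ _≡_ →
               (∃ λ f → F f ≢ 0ℚ) ⊎ (∀ f → F f ≡ 0ℚ)
nonzero⊎zero m {F = F} F-resp
  with anyFun? m (λ f≗f′ Ff≢0 → Ff≢0 ∘ trans (F-resp f≗f′)) (λ f → Dec.¬? (F f ℚP.≟ 0ℚ))
... | yes nonzero = inj₁ nonzero
... | no ¬nonzero = inj₂ (λ f → Dec.decidable-stable (F f ℚP.≟ 0ℚ) (λ Ff≢0 → ¬nonzero (f , Ff≢0)))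

sumFin-cong : ∀ {k} {F G : Fin k → ℚ} → F ≗ G → sumFin F ≡ sumFin G
sumFin-cong {zero}  F≗G = refl
sumFin-cong {suc k} F≗G = cong₂ _+_ (F≗G zero) (sumFin-cong (F≗G ∘ suc))

prodFin-cong : ∀ {k} {F G : Fin k → ℚ} → F ≗ G → prodFin F ≡ prodFin G
prodFin-cong {zero}  F≗G = refl
prodFin-cong {suc k} F≗G = cong₂ _*_ (F≗G zero) (prodFin-cong (F≗G ∘ suc))

sumFin-zero : ∀ {k} {F : Fin k → ℚ} → (∀ i → F i ≡ 0ℚ) → sumFin F ≡ 0ℚ
sumFin-zero {zero}  F≡0 = refl
sumFin-zero {suc k} F≡0 =
  trans (cong₂ _+_ (F≡0 zero) (sumFin-zero (F≡0 ∘ suc))) (ℚP.+-identityˡ 0ℚ)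

sumFin-distrib-+ : ∀ {k} (F G : Fin k → ℚ) → sumFin (λ i → F i + G i) ≡ sumFin F + sumFin G
sumFin-distrib-+ {zero}  F G = sym (ℚP.+-identityˡ 0ℚ)
sumFin-distrib-+ {suc k} F G =
  trans (cong (F zero + G zero +_) (sumFin-distrib-+ (F ∘ suc) (G ∘ suc)))
        (+-Props.interchange (F zero) (G zero) (sumFin (F ∘ suc)) (sumFin (G ∘ suc)))

*-distribˡ-sumFin : ∀ {k} c (F : Fin k → ℚ) → c * sumFin F ≡ sumFin (λ i → c * F i)
*-distribˡ-sumFin {zero}  c F = ℚP.*-zeroʳ c
*-distribˡ-sumFin {suc k} c F =
  trans (ℚP.*-distribˡ-+ c (F zero) (sumFin (F ∘ suc)))
        (cong (c * F zero +_) (*-distribˡ-sumFin c (F ∘ suc)))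

*-distribʳ-sumFin : ∀ {k} c (F : Fin k → ℚ) → sumFin F * c ≡ sumFin (λ i → F i * c)
*-distribʳ-sumFin {zero}  c F = ℚP.*-zeroˡ c
*-distribʳ-sumFin {suc k} c F =
  trans (ℚP.*-distribʳ-+ c (F zero) (sumFin (F ∘ suc)))
        (cong (F zero * c +_) (*-distribʳ-sumFin c (F ∘ suc)))

prodFin-distrib-* : ∀ {k} (F G : Fin k → ℚ) →
                    prodFin (λ i → F i * G i) ≡ prodFin F * prodFin G
prodFin-distrib-* {zero}  F G = sym (ℚP.*-identityˡ 1ℚ)
prodFin-distrib-* {suc k} F G =
  trans (cong (F zero * G zero *_) (prodFin-distrib-* (F ∘ suc) (G ∘ suc)))
        (*-Props.interchange (F zero) (G zero) (prodFin (F ∘ suc)) (prodFin (G ∘ suc)))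

prodFin-≡0 : ∀ {k} {F : Fin k → ℚ} i → F i ≡ 0ℚ → prodFin F ≡ 0ℚ
prodFin-≡0 {F = F} zero    Fi≡0 =
  trans (cong (_* prodFin (F ∘ suc)) Fi≡0) (ℚP.*-zeroˡ (prodFin (F ∘ suc)))
prodFin-≡0 {F = F} (suc i) Fi≡0 =
  trans (cong (F zero *_) (prodFin-≡0 i Fi≡0)) (ℚP.*-zeroʳ (F zero))

prodFin-≢0⇔ : ∀ {k} {F : Fin k → ℚ} → prodFin F ≢ 0ℚ ⇔ (∀ i → F i ≢ 0ℚ)
prodFin-≢0⇔ = mk⇔ (λ ∏≢0 i Fi≡0 → ∏≢0 (prodFin-≡0 i Fi≡0)) all≢0
  where
  all≢0 : ∀ {k} {F : Fin k → ℚ} → (∀ i → F i ≢ 0ℚ) → prodFin F ≢ 0ℚ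
  all≢0 {zero}  _   = λ ()
  all≢0 {suc k} F≢0 = *-≢0 (F≢0 zero) (all≢0 (F≢0 ∘ suc))

δ : ∀ {n} → Fin n → Fin n → ℚ
δ c t = if does (c Fin.≟ t) then 1ℚ else 0ℚ

sumFin-δ : ∀ {k} (G : Fin k → ℚ) t → sumFin (λ c → δ c t * G c) ≡ G t
sumFin-δ G zero    =
  trans (cong₂ _+_ (ℚP.*-identityˡ (G zero)) (sumFin-zero (λ c → ℚP.*-zeroˡ (G (suc c)))))
        (ℚP.+-identityʳ (G zero))
sumFin-δ G (suc t) =
  trans (cong₂ _+_ (ℚP.*-zeroˡ (G zero)) (sumFin-δ (G ∘ suc) t)) (ℚP.+-identityˡ (G (suc t)))

sumFuns-cong : ∀ {n} m {F G : (Fin m → Fin n) → ℚ} →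
               (∀ f → F f ≡ G f) → sumFuns m F ≡ sumFuns m G
sumFuns-cong zero    F≡G = F≡G _
sumFuns-cong (suc m) F≡G = sumFin-cong (λ c → sumFuns-cong m (λ h → F≡G (c ∷ᶠ h)))

sumFuns-zero : ∀ {n} m {F : (Fin m → Fin n) → ℚ} → (∀ f → F f ≡ 0ℚ) → sumFuns m F ≡ 0ℚ
sumFuns-zero zero    F≡0 = F≡0 _
sumFuns-zero (suc m) F≡0 = sumFin-zero (λ c → sumFuns-zero m (λ h → F≡0 (c ∷ᶠ h)))

sumFuns-distrib-+ : ∀ {n} m (F G : (Fin m → Fin n) → ℚ) →
                    sumFuns m (λ f → F f + G f) ≡ sumFuns m F + sumFuns m G
sumFuns-distrib-+ zero        F G = refl
sumFuns-distrib-+ {n} (suc m) F G =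
  trans (sumFin-cong {n} (λ c → sumFuns-distrib-+ m _ _)) (sumFin-distrib-+ {n} _ _)

*-distribˡ-sumFuns : ∀ {n} m c (F : (Fin m → Fin n) → ℚ) →
                     c * sumFuns m F ≡ sumFuns m (λ f → c * F f)
*-distribˡ-sumFuns zero        c F = refl
*-distribˡ-sumFuns {n} (suc m) c F =
  trans (*-distribˡ-sumFin {n} c _) (sumFin-cong {n} (λ d → *-distribˡ-sumFuns m c _))

*-distribʳ-sumFuns : ∀ {n} m c (F : (Fin m → Fin n) → ℚ) →
                     sumFuns m F * c ≡ sumFuns m (λ f → F f * c)
*-distribʳ-sumFuns zero        c F = refl
*-distribʳ-sumFuns {n} (suc m) c F =
  trans (*-distribʳ-sumFin {n} c _) (sumFin-cong {n} (λ d → *-distribʳ-sumFuns m c _))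

sumFuns-sumFin-comm : ∀ {n k} m (F : (Fin m → Fin n) → Fin k → ℚ) →
                      sumFuns m (λ f → sumFin (F f)) ≡ sumFin (λ i → sumFuns m (λ f → F f i))
sumFuns-sumFin-comm {k = zero}  m F = sumFuns-zero m (λ _ → refl)
sumFuns-sumFin-comm {k = suc k} m F =
  trans (sumFuns-distrib-+ m (λ f → F f zero) (λ f → sumFin (F f ∘ suc)))
        (cong (sumFuns m (λ f → F f zero) +_) (sumFuns-sumFin-comm m (λ f → F f ∘ suc)))

sumFuns-comm : ∀ {n n′} m m′ (F : (Fin m → Fin n) → (Fin m′ → Fin n′) → ℚ) →
               sumFuns m (λ f → sumFuns m′ (F f)) ≡ sumFuns m′ (λ f′ → sumFuns m (λ f → F f f′))
sumFuns-comm m zero                 F = refl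
sumFuns-comm {n′ = n′} m (suc m′) F =
  trans (sumFuns-sumFin-comm {k = n′} m _)
        (sumFin-cong (λ c → sumFuns-comm m m′ (λ f h → F f (c ∷ᶠ h))))

sumFuns-prodFin : ∀ {n} m (h : Fin m → Fin n → ℚ) →
                  sumFuns m (λ a → prodFin (λ i → h i (a i))) ≡ prodFin (λ i → sumFin (h i))
sumFuns-prodFin zero        h = refl
sumFuns-prodFin {n} (suc m) h = begin
  sumFin (λ (c : Fin n) → sumFuns m (λ a → h zero c * prodFin (λ i → h (suc i) (a i))))
    ≡⟨ sumFin-cong (λ c → *-distribˡ-sumFuns m (h zero c) _) ⟨
  sumFin (λ c → h zero c * sumFuns m (λ a → prodFin (λ i → h (suc i) (a i))))
    ≡⟨ sumFin-cong (λ c → cong (h zero c *_) (sumFuns-prodFin m (h ∘ suc))) ⟩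
  sumFin (λ c → h zero c * prodFin (λ i → sumFin (h (suc i))))
    ≡⟨ *-distribʳ-sumFin _ (h zero) ⟨
  sumFin (h zero) * prodFin (λ i → sumFin (h (suc i)))
    ∎
  where open ≡-Reasoning

sumFuns-δ : ∀ {n} m {F : (Fin m → Fin n) → ℚ} → F Preserves _≗_ ⟶ _≡_ → ∀ t →
            sumFuns m (λ f → F f * prodFin (λ i → δ (f i) (t i))) ≡ F t
sumFuns-δ zero    F-resp t = trans (ℚP.*-identityʳ _) (F-resp (λ ()))
sumFuns-δ {n} (suc m) {F} F-resp t = begin
  sumFin (λ (c : Fin n) → sumFuns m (λ h → F (c ∷ᶠ h) * (δ c t₀ * Δ h)))
    ≡⟨ sumFin-cong {n} (λ c → sumFuns-cong m (λ h → *-Props.x∙yz≈y∙xz (F (c ∷ᶠ h)) (δ c t₀) (Δ h))) ⟩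
  sumFin (λ c → sumFuns m (λ h → δ c t₀ * (F (c ∷ᶠ h) * Δ h)))
    ≡⟨ sumFin-cong {n} (λ c → *-distribˡ-sumFuns m (δ c t₀) (λ h → F (c ∷ᶠ h) * Δ h)) ⟨
  sumFin (λ c → δ c t₀ * sumFuns m (λ h → F (c ∷ᶠ h) * Δ h))
    ≡⟨ sumFin-cong (λ c → cong (δ c t₀ *_) (sumFuns-δ m (F-resp ∘ ∷-cong refl) (tail t))) ⟩
  sumFin (λ c → δ c t₀ * F (c ∷ᶠ tail t))
    ≡⟨ sumFin-δ (λ c → F (c ∷ᶠ tail t)) t₀ ⟩
  F (t₀ ∷ᶠ tail t)
    ≡⟨ F-resp (∷-cong refl λ _ → refl) ⟩
  F t ∎
  where
  open ≡-Reasoning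
  t₀ : Fin n
  t₀ = head t
  Δ : (Fin m → Fin n) → ℚ
  Δ h = prodFin (λ i → δ (h i) (tail t i))

eval : List ℚ → ℚ → ℚ
eval []      x = 0ℚ
eval (a ∷ p) x = a + x * eval p x

eval-polyAdd : ∀ p q x → eval (polyAdd p q) x ≡ eval p x + eval q x
eval-polyAdd []      q       x = sym (ℚP.+-identityˡ _)
eval-polyAdd (a ∷ p) []      x = sym (ℚP.+-identityʳ _)
eval-polyAdd (a ∷ p) (b ∷ q) x =
  trans (cong (λ s → a + b + x * s) (eval-polyAdd p q x)) (rearrange a b x (eval p x) (eval q x))
  where
  rearrange : ∀ a b x u v → a + b + x * (u + v) ≡ (a + x * u) + (b + x * v)
  rearrange = solve 5 (λ a b x u v → a :+ b :+ x :* (u :+ v) := (a :+ x :* u) :+ (b :+ x :* v)) refl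

eval-polyScale : ∀ c p x → eval (polyScale c p) x ≡ c * eval p x
eval-polyScale c []      x = sym (ℚP.*-zeroʳ c)
eval-polyScale c (a ∷ p) x =
  trans (cong (λ s → c * a + x * s) (eval-polyScale c p x)) (rearrange c a x (eval p x))
  where
  rearrange : ∀ c a x u → c * a + x * (c * u) ≡ c * (a + x * u)
  rearrange = solve 4 (λ c a x u → c :* a :+ x :* (c :* u) := c :* (a :+ x :* u)) refl

eval-polyMul : ∀ p q x → eval (polyMul p q) x ≡ eval p x * eval q x
eval-polyMul []      q x = sym (ℚP.*-zeroˡ (eval q x))
eval-polyMul (a ∷ p) q x = begin
  eval (polyAdd (polyScale a q) (0ℚ ∷ polyMul p q)) x
    ≡⟨ eval-polyAdd (polyScale a q) (0ℚ ∷ polyMul p q) x ⟩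
  eval (polyScale a q) x + (0ℚ + x * eval (polyMul p q) x)
    ≡⟨ cong₂ (λ u v → u + (0ℚ + x * v)) (eval-polyScale a q x) (eval-polyMul p q x) ⟩
  a * eval q x + (0ℚ + x * (eval p x * eval q x))
    ≡⟨ rearrange a x (eval p x) (eval q x) ⟩
  (a + x * eval p x) * eval q x ∎
  where
  open ≡-Reasoning
  rearrange : ∀ a x u v → a * v + (0ℚ + x * (u * v)) ≡ (a + x * u) * v
  rearrange = solve 4 (λ a x u v → a :* v :+ (con 0ℚ :+ x :* (u :* v)) := (a :+ x :* u) :* v) refl

eval-polyProdFin : ∀ {k} (F : Fin k → List ℚ) x →
                   eval (polyProdFin F) x ≡ prodFin (λ i → eval (F i) x)
eval-polyProdFin {zero}  F x = cong (1ℚ +_) (ℚP.*-zeroʳ x)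
eval-polyProdFin {suc k} F x =
  trans (eval-polyMul (F zero) _ x) (cong (eval (F zero) x *_) (eval-polyProdFin (F ∘ suc) x))

sumFin-coeffAt-^ : ∀ m p x → length p ≤ m →
                   sumFin {m} (λ k → coeffAt p (toℕ k) * x ^ toℕ k) ≡ eval p x
sumFin-coeffAt-^ m       []      x _         = sumFin-zero {m} (λ k → ℚP.*-zeroˡ (x ^ toℕ k))
sumFin-coeffAt-^ (suc m) (a ∷ p) x (s≤s p≤m) = begin
  a * 1ℚ + sumFin {m} (λ k → coeffAt p (toℕ k) * (x * x ^ toℕ k))
    ≡⟨ cong₂ _+_ (ℚP.*-identityʳ a) (sumFin-cong {m} (λ k → *-Props.x∙yz≈y∙xz (coeffAt p (toℕ k)) x _)) ⟩
  a + sumFin {m} (λ k → x * (coeffAt p (toℕ k) * x ^ toℕ k))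
    ≡⟨ cong (a +_) (*-distribˡ-sumFin {m} x _) ⟨
  a + x * sumFin {m} (λ k → coeffAt p (toℕ k) * x ^ toℕ k)
    ≡⟨ cong (λ s → a + x * s) (sumFin-coeffAt-^ m p x p≤m) ⟩
  a + x * eval p x ∎
  where open ≡-Reasoning

length-polyAdd : ∀ p q → length (polyAdd p q) ≡ length p ⊔ length q
length-polyAdd []      q       = refl
length-polyAdd (a ∷ p) []      = refl
length-polyAdd (a ∷ p) (b ∷ q) = cong suc (length-polyAdd p q)

-- In terms of degrees (length - 1): deg (p q) ≤ deg p + deg q.
length-polyMul : ∀ p q {d e} → length p ≤ d → length q ≤ suc e → length (polyMul p q) ≤ d ℕ.+ e
length-polyMul []      q _ _ = z≤n
length-polyMul (a ∷ p) q {suc d} {e} (s≤s p≤d) q≤1+e = begin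
  length (polyAdd (polyScale a q) (0ℚ ∷ polyMul p q)) ≡⟨ length-polyAdd (polyScale a q) _ ⟩
  length (polyScale a q) ⊔ suc (length (polyMul p q)) ≡⟨ cong (_⊔ _) (ListP.length-map (a *_) q) ⟩
  length q ⊔ suc (length (polyMul p q))                ≤⟨ ℕP.⊔-lub q≤1+d+e (s≤s pq≤d+e) ⟩
  suc d ℕ.+ e                                          ∎
  where
  open ℕP.≤-Reasoning
  q≤1+d+e : length q ≤ suc d ℕ.+ e
  q≤1+d+e = ℕP.≤-trans q≤1+e (s≤s (ℕP.m≤n+m e d))
  pq≤d+e : length (polyMul p q) ≤ d ℕ.+ e
  pq≤d+e = length-polyMul p q p≤d q≤1+e

length-polyProdFin-linear : ∀ {m} (F : Fin m → List ℚ) → (∀ j → length (F j) ≤ 2) →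
                            length (polyProdFin F) ≤ suc m
length-polyProdFin-linear {zero}  F _   = s≤s z≤n
length-polyProdFin-linear {suc m} F F≤2 =
  length-polyMul (F zero) _ (F≤2 zero) (length-polyProdFin-linear (F ∘ suc) (F≤2 ∘ suc))

length-polyProdFin-linear-but-one : ∀ {n} (F : Fin n → List ℚ) (c : Fin n) →
                                    (∀ j → length (F j) ≤ 2) → length (F c) ≤ 1 →
                                    length (polyProdFin F) ≤ n
length-polyProdFin-linear-but-one F zero F≤2 Fc≤1 =
  length-polyMul (F zero) _ Fc≤1 (length-polyProdFin-linear (F ∘ suc) (F≤2 ∘ suc))
length-polyProdFin-linear-but-one {suc (suc m)} F (suc c) F≤2 Fc≤1 =
  length-polyMul (F zero) _ (F≤2 zero)
    (length-polyProdFin-linear-but-one (F ∘ suc) c (F≤2 ∘ suc) Fc≤1)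

-- The Lagrange basis of the grid ℤ_n

lagrangeNumerator : ∀ n → Fin n → ℚ → ℚ
lagrangeNumerator n c x =
  prodFin (λ (j : Fin n) → if does (j Fin.≟ c) then 1ℚ else x - ℕtoℚ (toℕ j))

lagrangeFactor : ∀ n → Fin n → Fin n → List ℚ
lagrangeFactor n c j = if does (j Fin.≟ c) then 1ℚ ∷ [] else - ℕtoℚ (toℕ j) ∷ 1ℚ ∷ []

eval-lagrange : ∀ n c x →
  eval (lagrange n c) x ≡ recip (lagrangeNumerator n c (ℕtoℚ (toℕ c))) * lagrangeNumerator n c x
eval-lagrange n c x = begin
  eval (polyScale r (polyProdFin (lagrangeFactor n c))) x
    ≡⟨ eval-polyScale r (polyProdFin (lagrangeFactor n c)) x ⟩
  r * eval (polyProdFin (lagrangeFactor n c)) x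
    ≡⟨ cong (r *_) (eval-polyProdFin (lagrangeFactor n c) x) ⟩
  r * prodFin (λ j → eval (lagrangeFactor n c j) x)
    ≡⟨ cong (r *_) (prodFin-cong (λ j → eval-factor (does (j Fin.≟ c)) (ℕtoℚ (toℕ j)))) ⟩
  r * lagrangeNumerator n c x ∎
  where
  open ≡-Reasoning
  r : ℚ
  r = recip (lagrangeNumerator n c (ℕtoℚ (toℕ c)))
  eval-factor : ∀ b y → eval (if b then 1ℚ ∷ [] else - y ∷ 1ℚ ∷ []) x ≡ (if b then 1ℚ else x - y)
  eval-factor true  y = cong (1ℚ +_) (ℚP.*-zeroʳ x)
  eval-factor false y = solve 2 (λ x y → :- y :+ x :* (con 1ℚ :+ x :* con 0ℚ) := x :- y) refl x y

lagrangeNumerator-self-≢0 : ∀ n c → lagrangeNumerator n c (ℕtoℚ (toℕ c)) ≢ 0ℚ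
lagrangeNumerator-self-≢0 n c = Equivalence.from prodFin-≢0⇔ factor≢0
  where
  factor≢0 : ∀ j → (if does (j Fin.≟ c) then 1ℚ else ℕtoℚ (toℕ c) - ℕtoℚ (toℕ j)) ≢ 0ℚ
  factor≢0 j with j Fin.≟ c
  ... | yes _   = ℚP.1≢0
  ... | no  j≢c = λ c-j≡0 →
    j≢c (sym (FinP.toℕ-injective (ℕtoℚ-injective (+-GroupProps.x∙y⁻¹≈ε⇒x≈y _ _ c-j≡0))))

lagrangeNumerator-other-≡0 : ∀ n c {t} → t ≢ c → lagrangeNumerator n c (ℕtoℚ (toℕ t)) ≡ 0ℚ
lagrangeNumerator-other-≡0 n c {t} t≢c = prodFin-≡0 t factor≡0
  where
  factor≡0 : (if does (t Fin.≟ c) then 1ℚ else ℕtoℚ (toℕ t) - ℕtoℚ (toℕ t)) ≡ 0ℚ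
  factor≡0 rewrite Dec.dec-false (t Fin.≟ c) t≢c = ℚP.+-inverseʳ (ℕtoℚ (toℕ t))

lagrange-at-grid : ∀ n (c t : Fin n) → eval (lagrange n c) (ℕtoℚ (toℕ t)) ≡ δ c t
lagrange-at-grid n c t with c Fin.≟ t
... | yes refl = trans (eval-lagrange n c _) (recip-inverseˡ (lagrangeNumerator-self-≢0 n c))
... | no  c≢t  = trans (eval-lagrange n c _)
                       (trans (cong (r *_) (lagrangeNumerator-other-≡0 n c (c≢t ∘ sym))) (ℚP.*-zeroʳ r))
  where
  r : ℚ
  r = recip (lagrangeNumerator n c (ℕtoℚ (toℕ c)))

length-lagrange : ∀ n c → length (lagrange n c) ≤ n
length-lagrange n c =
  ℕP.≤-trans (ℕP.≤-reflexive (ListP.length-map _ (polyProdFin (lagrangeFactor n c))))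
             (length-polyProdFin-linear-but-one (lagrangeFactor n c) c
                (λ j → factor≤2 (does (j Fin.≟ c)) _) factor-c≤1)
  where
  factor≤2 : ∀ b y → length (if b then 1ℚ ∷ [] else - y ∷ 1ℚ ∷ []) ≤ 2
  factor≤2 true  y = s≤s z≤n
  factor≤2 false y = ℕP.≤-refl
  factor-c≤1 : length (lagrangeFactor n c c) ≤ 1
  factor-c≤1 rewrite Dec.dec-true (c Fin.≟ c) refl = ℕP.≤-refl

grid : ∀ {n} → (Fin n → Fin n) → Fin n → ℚ
grid t i = ℕtoℚ (toℕ (t i))

monomial : ∀ {n} → (Fin n → Fin n) → (Fin n → ℚ) → ℚ
monomial a x = prodFin (λ i → x i ^ toℕ (a i))

coeffL-at-grid : ∀ {n} (f t : Fin n → Fin n) →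
                 sumFuns n (λ a → coeffL f a * monomial a (grid t)) ≡ prodFin (λ i → δ (f i) (t i))
coeffL-at-grid {n} f t = begin
  sumFuns n (λ a → coeffL f a * monomial a (grid t))
    ≡⟨ sumFuns-cong n (λ a → prodFin-distrib-* {n} _ _) ⟨
  sumFuns n (λ a → prodFin (λ i → term i (a i)))
    ≡⟨ sumFuns-prodFin n term ⟩
  prodFin (λ i → sumFin (term i))
    ≡⟨ prodFin-cong (λ i → trans (sumFin-coeffAt-^ n (lagrange n (f i)) (grid t i) (length-lagrange n (f i)))
                                 (lagrange-at-grid n (f i) (t i))) ⟩
  prodFin (λ i → δ (f i) (t i)) ∎
  where
  open ≡-Reasoning
  term : Fin n → Fin n → ℚ
  term i k = coeffAt (lagrange n (f i)) (toℕ k) * grid t i ^ toℕ k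

-- Interpolation on the grid

interpolationCoeff : ∀ {n} → ((Fin n → Fin n) → ℚ) → (Fin n → Fin n) → ℚ
interpolationCoeff {n} F a = sumFuns n (λ f → F f * coeffL f a)

interpolationCoeff-cong : ∀ {n} (F : (Fin n → Fin n) → ℚ) →
                          interpolationCoeff F Preserves _≗_ ⟶ _≡_
interpolationCoeff-cong {n} F a≗a′ = sumFuns-cong n (λ f → cong (F f *_)
  (prodFin-cong (λ i → cong (coeffAt (lagrange n (f i)) ∘ toℕ) (a≗a′ i))))

interpolation-at-grid : ∀ {n} {F : (Fin n → Fin n) → ℚ} → F Preserves _≗_ ⟶ _≡_ → ∀ t →
                        sumFuns n (λ a → interpolationCoeff F a * monomial a (grid t)) ≡ F t
interpolation-at-grid {n} {F} F-resp t = begin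
  sumFuns n (λ a → sumFuns n (λ f → F f * coeffL f a) * x^ a)
    ≡⟨ sumFuns-cong n (λ a → *-distribʳ-sumFuns n (x^ a) _) ⟩
  sumFuns n (λ a → sumFuns n (λ f → F f * coeffL f a * x^ a))
    ≡⟨ sumFuns-comm n n _ ⟩
  sumFuns n (λ f → sumFuns n (λ a → F f * coeffL f a * x^ a))
    ≡⟨ sumFuns-cong n (λ f → sumFuns-cong n (λ a → ℚP.*-assoc (F f) (coeffL f a) (x^ a))) ⟩
  sumFuns n (λ f → sumFuns n (λ a → F f * (coeffL f a * x^ a)))
    ≡⟨ sumFuns-cong n (λ f → *-distribˡ-sumFuns n (F f) _) ⟨
  sumFuns n (λ f → F f * sumFuns n (λ a → coeffL f a * x^ a))
    ≡⟨ sumFuns-cong n (λ f → cong (F f *_) (coeffL-at-grid f t)) ⟩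
  sumFuns n (λ f → F f * prodFin (λ i → δ (f i) (t i)))
    ≡⟨ sumFuns-δ n F-resp t ⟩
  F t ∎
  where
  open ≡-Reasoning
  x^ : (Fin n → Fin n) → ℚ
  x^ a = monomial a (grid t)

interpolation-≢0⇔ : ∀ {n} {F : (Fin n → Fin n) → ℚ} → F Preserves _≗_ ⟶ _≡_ →
                    (∃ λ a → interpolationCoeff F a ≢ 0ℚ) ⇔ (∃ λ t → F t ≢ 0ℚ)
interpolation-≢0⇔ {n} {F} F-resp = mk⇔ coeff⇒value value⇒coeff
  where
  coeff⇒value : (∃ λ a → interpolationCoeff F a ≢ 0ℚ) → ∃ λ t → F t ≢ 0ℚ
  coeff⇒value (a , coeff≢0) with nonzero⊎zero n F-resp
  ... | inj₁ value≢0 = value≢0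
  ... | inj₂ F≡0     = contradiction
    (sumFuns-zero n (λ f → trans (cong (_* coeffL f a) (F≡0 f)) (ℚP.*-zeroˡ (coeffL f a))))
    coeff≢0
  value⇒coeff : (∃ λ t → F t ≢ 0ℚ) → ∃ λ a → interpolationCoeff F a ≢ 0ℚ
  value⇒coeff (t , Ft≢0) with nonzero⊎zero n (interpolationCoeff-cong F)
  ... | inj₁ coeff≢0 = coeff≢0
  ... | inj₂ coeff≡0 = contradiction
    (trans (sym (interpolation-at-grid F-resp t))
           (sumFuns-zero n (λ a → trans (cong (_* monomial a (grid t)) (coeff≡0 a))
                                        (ℚP.*-zeroˡ (monomial a (grid t))))))
    Ft≢0

prodPairs-cong : ∀ {n} {F G : Fin n → Fin n → ℚ} →
                 (∀ u v → F u v ≡ G u v) → prodPairs F ≡ prodPairs G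
prodPairs-cong {n} F≡G = prodFin-cong {n} (λ v → prodFin-cong {n} (λ u →
  cong (λ z → if toℕ u ℕ.<ᵇ toℕ v then z else 1ℚ) (F≡G u v)))

evalP-cong : ∀ {n} (g : Fin n → Fin n) → evalP g Preserves _≗_ ⟶ _≡_
evalP-cong {n} g {x} {y} x≗y =
  cong₂ _*_ (cong₂ _*_ (prodPairs-cong (λ u v → cong₂ _-_ (x≗y v) (x≗y u)))
                       (prodPairs-cong (λ u v → cong₂ _-_ (e≗e′ v) (e≗e′ u))))
            (prodFin-cong {n} (λ v → prodFin-cong {n} (λ i →
               cong (λ z → if toℕ i ℕ.≡ᵇ 0 then 1ℚ else z + ℕtoℚ (toℕ i)) (e≗e′ v))))
  where
  e≗e′ : edgeVal g x ≗ edgeVal g y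
  e≗e′ v = cong (negPowℚ (depth g v) *_) (cong₂ _-_ (x≗y (g v)) (x≗y v))

-- canonCoeff g is, by definition, interpolationCoeff (λ t → evalP g (grid t)).
canonNonzero⇔gridNonzero : ∀ {n} (g : Fin n → Fin n) →
                           CanonNonzero g ⇔ (∃ λ t → evalP g (grid t) ≢ 0ℚ)
canonNonzero⇔gridNonzero g =
  interpolation-≢0⇔ (λ t≗t′ → evalP-cong g (cong (ℕtoℚ ∘ toℕ) ∘ t≗t′))

-- Nonvanishing of P_g

prodPairs-≡0 : ∀ {n} {F : Fin n → Fin n → ℚ} {u v} →
               toℕ u < toℕ v → F u v ≡ 0ℚ → prodPairs F ≡ 0ℚ
prodPairs-≡0 {F = F} {u} {v} u<v Fuv≡0 = prodFin-≡0 v (prodFin-≡0 u factor≡0)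
  where
  factor≡0 : (if toℕ u ℕ.<ᵇ toℕ v then F u v else 1ℚ) ≡ 0ℚ
  factor≡0 rewrite Equivalence.to BoolP.T-≡ (ℕP.<⇒<ᵇ u<v) = Fuv≡0

prodPairs-≢0 : ∀ {n} {F : Fin n → Fin n → ℚ} →
               (∀ {u v} → toℕ u < toℕ v → F u v ≢ 0ℚ) → prodPairs F ≢ 0ℚ
prodPairs-≢0 {F = F} F≢0 =
  Equivalence.from prodFin-≢0⇔ (λ v → Equivalence.from prodFin-≢0⇔ (λ u → factor≢0 u v))
  where
  factor≢0 : ∀ u v → (if toℕ u ℕ.<ᵇ toℕ v then F u v else 1ℚ) ≢ 0ℚ
  factor≢0 u v with toℕ u ℕ.<ᵇ toℕ v | ℕP.<ᵇ⇒< (toℕ u) (toℕ v)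
  ... | true  | u<v = F≢0 (u<v _)
  ... | false | _   = ℚP.1≢0

vandermonde-≢0⇔ : ∀ {n} (x : Fin n → ℚ) →
                  prodPairs (λ u v → x v - x u) ≢ 0ℚ ⇔ Injective _≡_ _≡_ x
vandermonde-≢0⇔ x = mk⇔ injective (λ x-inj → prodPairs-≢0 (λ u<v xv-xu≡0 →
  ℕP.<⇒≢ u<v (cong toℕ (sym (x-inj (+-GroupProps.x∙y⁻¹≈ε⇒x≈y _ _ xv-xu≡0))))))
  where
  injective : prodPairs (λ u v → x v - x u) ≢ 0ℚ → Injective _≡_ _≡_ x
  injective ∏≢0 {u} {v} xu≡xv with ℕP.<-cmp (toℕ u) (toℕ v)
  ... | tri< u<v _ _ =
    contradiction (prodPairs-≡0 u<v (+-GroupProps.x≈y⇒x∙y⁻¹≈ε (sym xu≡xv))) ∏≢0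
  ... | tri≈ _ u≡v _ = FinP.toℕ-injective u≡v
  ... | tri> _ _ v<u =
    contradiction (prodPairs-≡0 v<u (+-GroupProps.x≈y⇒x∙y⁻¹≈ε xu≡xv)) ∏≢0

if-≡ᵇ0-≢0⇔ : ∀ m {q} → (if m ℕ.≡ᵇ 0 then 1ℚ else q) ≢ 0ℚ ⇔ (m ≢ 0 → q ≢ 0ℚ)
if-≡ᵇ0-≢0⇔ zero    = mk⇔ (λ _ 0≢0 → contradiction refl 0≢0) (λ _ → ℚP.1≢0)
if-≡ᵇ0-≢0⇔ (suc m) = mk⇔ (λ q≢0 _ → q≢0) (λ q≢0 → q≢0 ℕP.1+n≢0)

ShiftsNonzero : ∀ {n} → (Fin n → ℚ) → Set
ShiftsNonzero {n} e = ∀ v (i : Fin n) → toℕ i ≢ 0 → e v + ℕtoℚ (toℕ i) ≢ 0ℚ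

evalP-≢0⇔ : ∀ {n} (g : Fin n → Fin n) (x : Fin n → ℚ) →
            evalP g x ≢ 0ℚ ⇔
            (Injective _≡_ _≡_ x × Injective _≡_ _≡_ (edgeVal g x) × ShiftsNonzero (edgeVal g x))
evalP-≢0⇔ {n} g x = mk⇔
  (λ P≢0 → let AB≢0 , C≢0 = Equivalence.to *-≢0⇔ P≢0
               A≢0  , B≢0 = Equivalence.to *-≢0⇔ AB≢0
           in (λ {_ _} → Equivalence.to (vandermonde-≢0⇔ x) A≢0)
            , (λ {_ _} → Equivalence.to (vandermonde-≢0⇔ e) B≢0)
            , shifts C≢0)
  (λ (x-inj , e-inj , e-shifts) →
    *-≢0 (*-≢0 (Equivalence.from (vandermonde-≢0⇔ x) x-inj) (Equivalence.from (vandermonde-≢0⇔ e) e-inj))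
         (Equivalence.from prodFin-≢0⇔ (λ v → Equivalence.from prodFin-≢0⇔ (λ i →
            Equivalence.from (if-≡ᵇ0-≢0⇔ (toℕ i)) (e-shifts v i)))))
  where
  e : Fin n → ℚ
  e = edgeVal g x
  shifts : prodFin (λ v → prodFin (λ (i : Fin n) → if toℕ i ℕ.≡ᵇ 0 then 1ℚ else e v + ℕtoℚ (toℕ i)))
           ≢ 0ℚ → ShiftsNonzero e
  shifts C≢0 v i = Equivalence.to (if-≡ᵇ0-≢0⇔ (toℕ i))
                     (Equivalence.to prodFin-≢0⇔ (Equivalence.to prodFin-≢0⇔ C≢0 v) i)

edgeLabel : ∀ {n} → (Fin n → Fin n) → (Fin n → Fin n) → Fin n → ℤ
edgeLabel g t v = negPowℤ (depth g v) ℤ.* (ℤ.+ toℕ (t (g v)) ℤ.- ℤ.+ toℕ (t v))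

ℤtoℚ-negPowℤ : ∀ d → ℤtoℚ (negPowℤ d) ≡ negPowℚ d
ℤtoℚ-negPowℤ zero    = refl
ℤtoℚ-negPowℤ (suc d) = trans (ℤtoℚ-homo‿- (negPowℤ d)) (cong -_ (ℤtoℚ-negPowℤ d))

edgeVal-grid : ∀ {n} (g t : Fin n → Fin n) → edgeVal g (grid t) ≗ ℤtoℚ ∘ edgeLabel g t
edgeVal-grid g t v = sym (trans (ℤtoℚ-homo-* (negPowℤ (depth g v)) _)
  (cong₂ _*_ (ℤtoℚ-negPowℤ (depth g v)) (ℤtoℚ-homo-- (ℤ.+ toℕ (t (g v))) (ℤ.+ toℕ (t v)))))

∣negPowℤ*i∣≡∣i∣ : ∀ d i → ∣ negPowℤ d ℤ.* i ∣ ≡ ∣ i ∣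
∣negPowℤ*i∣≡∣i∣ zero    i = cong ∣_∣ (ℤP.*-identityˡ i)
∣negPowℤ*i∣≡∣i∣ (suc d) i = begin
  ∣ ℤ.- negPowℤ d ℤ.* i ∣   ≡⟨ cong ∣_∣ (ℤP.neg-distribˡ-* (negPowℤ d) i) ⟨
  ∣ ℤ.- (negPowℤ d ℤ.* i) ∣ ≡⟨ ℤP.∣-i∣≡∣i∣ (negPowℤ d ℤ.* i) ⟩
  ∣ negPowℤ d ℤ.* i ∣       ≡⟨ ∣negPowℤ*i∣≡∣i∣ d i ⟩
  ∣ i ∣                     ∎
  where open ≡-Reasoning

∣m⊖n∣<o : ∀ {m n o} → m < o → n < o → ∣ m ℤ.⊖ n ∣ < o
∣m⊖n∣<o {m} {n} m<o n<o with ℕP.≤-total m n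
... | inj₁ m≤n = ℕP.≤-<-trans (ℕP.≤-reflexive (ℤP.∣⊖∣-≤ m≤n)) (ℕP.≤-<-trans (ℕP.m∸n≤m n m) n<o)
... | inj₂ n≤m = ℕP.≤-<-trans (ℕP.≤-reflexive (trans (ℤP.∣m⊖n∣≡∣n⊖m∣ m n) (ℤP.∣⊖∣-≤ n≤m)))
                              (ℕP.≤-<-trans (ℕP.m∸n≤m m n) m<o)

∣edgeLabel∣<n : ∀ {n} (g t : Fin n → Fin n) v → ∣ edgeLabel g t v ∣ < n
∣edgeLabel∣<n g t v = subst (_< _)
  (sym (trans (∣negPowℤ*i∣≡∣i∣ (depth g v) _) (cong ∣_∣ (ℤP.m-n≡m⊖n (toℕ (t (g v))) (toℕ (t v))))))
  (∣m⊖n∣<o (FinP.toℕ<n (t (g v))) (FinP.toℕ<n (t v)))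

-- LabelsAreZn h unfolds to ImageIsZn (labelℤ h).
ImageIsZn : ∀ {n} → (Fin n → ℤ) → Set
ImageIsZn {n} ℓ =
  (∀ v → ∃ λ (k : Fin n) → ℓ v ≡ ℤ.+ toℕ k) × (∀ (k : Fin n) → ∃ λ v → ℓ v ≡ ℤ.+ toℕ k)

ImageIsZn-cong : ∀ {n} {ℓ ℓ′ : Fin n → ℤ} → ℓ ≗ ℓ′ → ImageIsZn ℓ → ImageIsZn ℓ′
ImageIsZn-cong ℓ≗ℓ′ (into , onto) =
  (λ v → let k , ℓv≡k = into v in k , trans (sym (ℓ≗ℓ′ v)) ℓv≡k) ,
  (λ k → let v , ℓv≡k = onto k in v , trans (sym (ℓ≗ℓ′ v)) ℓv≡k)

ImageIsZn-∘ : ∀ {n} {ℓ : Fin n → ℤ} {σ : Fin n → Fin n} →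
              StrictlySurjective _≡_ σ → ImageIsZn ℓ → ImageIsZn (ℓ ∘ σ)
ImageIsZn-∘ {ℓ = ℓ} σ-surj (into , onto) =
  (into ∘ _) ,
  (λ k → let v , ℓv≡k = onto k ; w , σw≡v = σ-surj v in w , trans (cong ℓ σw≡v) ℓv≡k)

AvoidsNegatives : ∀ {n} → (Fin n → ℤ) → Set
AvoidsNegatives {n} ℓ = ∀ v (i : Fin n) → toℕ i ≢ 0 → ℓ v ℤ.+ ℤ.+ toℕ i ≢ 0ℤ

avoidsNegatives⇒inZn : ∀ {n} z → ∣ z ∣ < n → (∀ (i : Fin n) → toℕ i ≢ 0 → z ℤ.+ ℤ.+ toℕ i ≢ 0ℤ) →
                       ∃ λ (k : Fin n) → z ≡ ℤ.+ toℕ k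
avoidsNegatives⇒inZn (ℤ.+ k)  k<n _ = Fin.fromℕ< k<n , cong ℤ.+_ (sym (FinP.toℕ-fromℕ< k<n))
avoidsNegatives⇒inZn -[1+ k ] k<n avoids = contradiction
  (trans (cong (λ m → -[1+ k ] ℤ.+ ℤ.+ m) (FinP.toℕ-fromℕ< k<n)) (ℤP.+-inverseˡ (ℤ.+ suc k)))
  (avoids (Fin.fromℕ< k<n) (λ i≡0 → ℕP.1+n≢0 (trans (sym (FinP.toℕ-fromℕ< k<n)) i≡0)))

imageIsZn⇔ : ∀ {n} {ℓ : Fin n → ℤ} → (∀ v → ∣ ℓ v ∣ < n) →
             ImageIsZn ℓ ⇔ (Injective _≡_ _≡_ ℓ × AvoidsNegatives ℓ)
imageIsZn⇔ {n} {ℓ} ∣ℓ∣<n = mk⇔ (λ im → (λ {_ _} → injective im) , avoids im) image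
  where
  toZn-injective : ∀ {k k′ : Fin n} → ℤ.+ toℕ k ≡ ℤ.+ toℕ k′ → k ≡ k′
  toZn-injective = FinP.toℕ-injective ∘ ℤP.+-injective

  injective : ImageIsZn ℓ → Injective _≡_ _≡_ ℓ
  injective (into , onto) {u} {v} ℓu≡ℓv =
    strictlySurjective⇒injective k-surjective
      (toZn-injective (trans (sym (proj₂ (into u))) (trans ℓu≡ℓv (proj₂ (into v)))))
    where
    k-surjective : StrictlySurjective _≡_ (proj₁ ∘ into)
    k-surjective k = let v , ℓv≡k = onto k in
                     v , toZn-injective (trans (sym (proj₂ (into v))) ℓv≡k)

  avoids : ImageIsZn ℓ → AvoidsNegatives ℓ
  avoids (into , _) v i i≢0 ℓv+i≡0 = let k , ℓv≡k = into v in
    i≢0 (ℕP.m+n≡0⇒n≡0 (toℕ k) (ℤP.+-injective (trans (sym (cong (ℤ._+ ℤ.+ toℕ i) ℓv≡k)) ℓv+i≡0)))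

  image : Injective _≡_ _≡_ ℓ × AvoidsNegatives ℓ → ImageIsZn ℓ
  image (ℓ-inj , ℓ-avoids) = into , onto
    where
    into : ∀ v → ∃ λ (k : Fin n) → ℓ v ≡ ℤ.+ toℕ k
    into v = avoidsNegatives⇒inZn (ℓ v) (∣ℓ∣<n v) (ℓ-avoids v)
    k-injective : Injective _≡_ _≡_ (proj₁ ∘ into)
    k-injective {u} {v} ku≡kv =
      ℓ-inj (trans (proj₂ (into u)) (trans (cong (ℤ.+_ ∘ toℕ) ku≡kv) (sym (proj₂ (into v)))))
    onto : ∀ k → ∃ λ v → ℓ v ≡ ℤ.+ toℕ k
    onto k = let v , kv≡k = injective⇒strictlySurjective k-injective k in
             v , trans (proj₂ (into v)) (cong (ℤ.+_ ∘ toℕ) kv≡k)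

gridNonzero⇔ : ∀ {n} (g t : Fin n → Fin n) →
               evalP g (grid t) ≢ 0ℚ ⇔ (Injective _≡_ _≡_ t × ImageIsZn (edgeLabel g t))
gridNonzero⇔ g t =
  ⇔-trans (evalP-≢0⇔ g (grid t))
          (grid-injective⇔ ×-⇔ ⇔-trans (label-injective⇔ ×-⇔ avoids⇔)
                                       (⇔-sym (imageIsZn⇔ (∣edgeLabel∣<n g t))))
  where
  ℓ : Fin _ → ℤ
  ℓ = edgeLabel g t
  grid-injective⇔ : Injective _≡_ _≡_ (grid t) ⇔ Injective _≡_ _≡_ t
  grid-injective⇔ = mk⇔
    (λ x-inj {_ _} tu≡tv → x-inj (cong (ℕtoℚ ∘ toℕ) tu≡tv))
    (λ t-inj {_ _} xu≡xv → t-inj (FinP.toℕ-injective (ℕtoℚ-injective xu≡xv)))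
  label-injective⇔ : Injective _≡_ _≡_ (edgeVal g (grid t)) ⇔ Injective _≡_ _≡_ ℓ
  label-injective⇔ = mk⇔
    (λ e-inj {u} {v} ℓu≡ℓv →
      e-inj (trans (edgeVal-grid g t u) (trans (cong ℤtoℚ ℓu≡ℓv) (sym (edgeVal-grid g t v)))))
    (λ ℓ-inj {u} {v} eu≡ev →
      ℓ-inj (ℤtoℚ-injective (trans (sym (edgeVal-grid g t u)) (trans eu≡ev (edgeVal-grid g t v)))))
  shift : ∀ v k → edgeVal g (grid t) v + ℕtoℚ k ≡ ℤtoℚ (ℓ v ℤ.+ ℤ.+ k)
  shift v k = trans (cong (_+ ℕtoℚ k) (edgeVal-grid g t v)) (sym (ℤtoℚ-homo-+ (ℓ v) (ℤ.+ k)))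
  avoids⇔ : ShiftsNonzero (edgeVal g (grid t)) ⇔ AvoidsNegatives ℓ
  avoids⇔ = mk⇔
    (λ e-shifts v i i≢0 ℓv+i≡0 → e-shifts v i i≢0 (trans (shift v (toℕ i)) (cong ℤtoℚ ℓv+i≡0)))
    (λ ℓ-avoids v i i≢0 e+i≡0 → ℓ-avoids v i i≢0 (ℤtoℚ-injective (trans (sym (shift v (toℕ i))) e+i≡0)))

-- Conjugation

firstFrom-cong : ∀ i fuel {p q : ℕ → Bool} → p ≗ q → firstFrom i fuel p ≡ firstFrom i fuel q
firstFrom-cong i zero       p≗q = refl
firstFrom-cong i (suc fuel) p≗q =
  cong₂ (if_then i else_) (p≗q i) (firstFrom-cong (suc i) fuel p≗q)

module _ {n} (φ : Fin n ↔ Fin n) (g : Fin n → Fin n) where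
  open Inverse φ

  iter-conj : ∀ j v → iter (conj φ g) j (to v) ≡ to (iter g j v)
  iter-conj zero    v = refl
  iter-conj (suc j) v =
    cong (to ∘ g) (trans (cong from (iter-conj j v)) (strictlyInverseʳ (iter g j v)))

  depth-conj : ∀ v → depth (conj φ g) (to v) ≡ depth g v
  depth-conj v = firstFrom-cong 0 n same-test
    where
    same-test : ∀ j → does (iter (conj φ g) j (to v) Fin.≟ iter (conj φ g) (n ∸ 1) (to v))
                    ≡ does (iter g j v Fin.≟ iter g (n ∸ 1) v)
    same-test j =
      trans (cong₂ (λ a b → does (a Fin.≟ b)) (iter-conj j v) (iter-conj (n ∸ 1) v))
            (Dec.does-⇔ (mk⇔ (Injection.injective (↔⇒↣ φ)) (cong to))
                        (to (iter g j v) Fin.≟ to (iter g (n ∸ 1) v)) (iter g j v Fin.≟ iter g (n ∸ 1) v))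

  labelℤ-conj : ∀ v → labelℤ (conj φ g) (to v) ≡ edgeLabel g to v
  labelℤ-conj v = cong₂ (λ d w → negPowℤ d ℤ.* (ℤ.+ toℕ (to (g w)) ℤ.- ℤ.+ toℕ (to v)))
                        (depth-conj v) (strictlyInverseʳ v)

phiNonempty⇔gridNonzero : ∀ {n} (g : Fin n → Fin n) →
                          PhiNonempty g ⇔ (∃ λ t → evalP g (grid t) ≢ 0ℚ)
phiNonempty⇔gridNonzero g = mk⇔
  (λ (φ , labels) → let open Inverse φ in
    to , Equivalence.from (gridNonzero⇔ g to)
           ( (λ {_ _} → Injection.injective (↔⇒↣ φ))
           , ImageIsZn-cong (labelℤ-conj φ g) (ImageIsZn-∘ (λ v → from v , strictlyInverseˡ v) labels)))
  (λ (t , P≢0) → let t-inj , labels = Equivalence.to (gridNonzero⇔ g t) P≢0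
                     φ = injective⇒↔ t-inj
                     open Inverse φ in
    φ , ImageIsZn-cong (λ v → trans (sym (labelℤ-conj φ g (from v)))
                                    (cong (labelℤ (conj φ g)) (strictlyInverseˡ v)))
                       (ImageIsZn-∘ (λ v → to v , strictlyInverseʳ v) labels))

proposition3p4 : ∀ (n : ℕ) → 1 ≤ n → (g : Fin n → Fin n) → RootedFun n g →
    (PhiNonempty g → CanonNonzero g) × (CanonNonzero g → PhiNonempty g)
proposition3p4 n _ g _ = Equivalence.to phi⇔canon , Equivalence.from phi⇔canon
  where
  phi⇔canon : PhiNonempty g ⇔ CanonNonzero g
  phi⇔canon = ⇔-trans (phiNonempty⇔gridNonzero g) (⇔-sym (canonNonzero⇔gridNonzero g))
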